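{- Let $\mathbf a=(a_1,\dots,a_{10})\in\mathbb N^{10}$ and $\beta=(\beta_1,\dots,\beta_{10})\in\mathbb Z^{10}$ with $B_{\mathbf a}(\alpha,\beta)=1$. Suppose there are distinct indices $j_1,j_2,j_3\in\{1,\dots,10\}$ with $\beta_{j_1}=\beta_{j_2}=\beta_{j_3}$ and $a_{j_1}\equiv a_{j_2}\equiv a_{j_3}\equiv 1\pmod 2$. (1) If $a_{j_1}\not\equiv a_{j_2}\pmod 4$ or $a_{j_1}\not\equiv a_{j_3}\pmod 4$, then $L_{\mathbf a,\beta}\otimes\mathbb Z_2$ is even universal. (2) If $a_{j_1}\equiv a_{j_2}\equiv a_{j_3}\pmod 4$, then $L_{\mathbf a,\beta}\otimes\mathbb Z_2$ represents every $2$-adic integer of odd $2$-adic order. (3) If $a_{j_1}\equiv a_{j_2}\equiv a_{j_3}\pmod 4$ and there is a further index $j_4$, distinct from $j_1,j_2,j_3$, with $\beta_{j_4}=\beta_{j_1}$ and $a_{j_4}\equiv 2\pmod 4$, then $L_{\mathbf a,\beta}\otimes\mathbb Z_2$ is even universal.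
   Context: $Q_{\mathbf a}(\mathbf x)=\sum a_ix_i^2$, $B_{\mathbf a}(\mathbf x,\mathbf y)=\sum a_ix_iy_i$, $\alpha=(1,\dots,1)\in\mathbb Z^{10}$, $L_{\mathbf a,\beta}=\{\mathbf x\in\mathbb Z^{10}: B_{\mathbf a}(\alpha,\mathbf x)=B_{\mathbf a}(\beta,\mathbf x)=0\}$ with form $Q_{\mathbf a}$. A $\mathbb Z_2$-lattice is even universal if it represents every element of $2\mathbb Z_2$. -}

module Defs where

open import Data.Nat as ℕ using (ℕ; zero; suc; _%_)
open import Data.Integer as ℤ using (ℤ; +_; _+_; _*_; _-_)
open import Data.Integer.Divisibility using (_∣_)
open import Data.Fin as Fin using (Fin)
open import Data.Product using (Σ; _×_; ∃; ∃-syntax)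
open import Relation.Binary.PropositionalEquality using (_≡_)

_≡_[mod_] : ℤ → ℤ → ℕ → Set
a ≡ b [mod n ] = (+ n) ∣ (a - b)

Σℤ : (n : ℕ) → (Fin n → ℤ) → ℤ
Σℤ zero    f = + 0
Σℤ (suc n) f = f Fin.zero + Σℤ n (λ i → f (Fin.suc i))

Bℤ : (Fin 10 → ℕ) → (Fin 10 → ℤ) → (Fin 10 → ℤ) → ℤ
Bℤ a x y = Σℤ 10 (λ i → (+ a i) * x i * y i)

αℤ : Fin 10 → ℤ
αℤ _ = + 1

-- 2-adic integers ℤ₂ = lim ℤ/2^k, as coherent sequences of approximations:
-- seq x k is a representative of x modulo 2^k, and
-- seq x (k+1) ≡ seq x k (mod 2^k).

Seq : Set
Seq = ℕ → ℤ

Coherent : Seq → Set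
Coherent x = ∀ k → x (suc k) ≡ x k [mod 2 ℕ.^ k ]

record ℤ₂ : Set where
  constructor mkℤ₂
  field
    seq : Seq
    coh : Coherent seq
open ℤ₂ public

_≈₂_ : Seq → Seq → Set
x ≈₂ y = ∀ k → x k ≡ y k [mod 2 ℕ.^ k ]

-- Ring operations and embedding ℤ → ℤ₂, computed levelwise on
-- approximations (levelwise operations preserve coherence).
const₂ : ℤ → Seq
const₂ c _ = c

_+ₛ_ : Seq → Seq → Seq
(x +ₛ y) k = x k + y k

_*ₛ_ : Seq → Seq → Seq
(x *ₛ y) k = x k * y k

infixl 6 _+ₛ_
infixl 7 _*ₛ_

ΣSeq : (n : ℕ) → (Fin n → Seq) → Seq
ΣSeq n f k = Σℤ n (λ i → f i k)

-- The ℤ₂-lattice  L_{a,β} ⊗ ℤ₂  =  { x ∈ ℤ₂^10 : B_a(α,x) = B_a(β,x) = 0 }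
-- (ℤ₂ is flat over ℤ, so the tensor product of the kernel is the kernel
-- of the same integral linear conditions over ℤ₂), with form Q_a.

B₂ : (Fin 10 → ℕ) → (Fin 10 → ℤ) → (Fin 10 → ℤ₂) → Seq
B₂ a y x = ΣSeq 10 (λ i → const₂ (+ a i * y i) *ₛ seq (x i))

Q₂ : (Fin 10 → ℕ) → (Fin 10 → ℤ₂) → Seq
Q₂ a x = ΣSeq 10 (λ i → const₂ (+ a i) *ₛ seq (x i) *ₛ seq (x i))

Represents : (Fin 10 → ℕ) → (Fin 10 → ℤ) → ℤ₂ → Set
Represents a β c =
  Σ (Fin 10 → ℤ₂) λ x →
    (B₂ a αℤ x ≈₂ const₂ (+ 0)) ×
    (B₂ a β x ≈₂ const₂ (+ 0)) ×
    (Q₂ a x ≈₂ seq c)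

In2ℤ₂ : ℤ₂ → Set
In2ℤ₂ c = Σ ℤ₂ λ y → seq c ≈₂ (const₂ (+ 2) *ₛ seq y)

Unit₂ : ℤ₂ → Set
Unit₂ u = Σ ℤ₂ λ v → (seq u *ₛ seq v) ≈₂ const₂ (+ 1)

OddOrder₂ : ℤ₂ → Set
OddOrder₂ c =
  Σ ℕ λ m → Σ ℤ₂ λ u →
    (m % 2 ≡ 1) × Unit₂ u × (seq c ≈₂ (const₂ (+ (2 ℕ.^ m)) *ₛ seq u))

EvenUniversal : (Fin 10 → ℕ) → (Fin 10 → ℤ) → Set
EvenUniversal a β = (c : ℤ₂) → In2ℤ₂ c → Represents a β c

RepresentsOddOrder : (Fin 10 → ℕ) → (Fin 10 → ℤ) → Set
RepresentsOddOrder a β = (c : ℤ₂) → OddOrder₂ c → Represents a β c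

{-# OPTIONS --safe #-}
module Submission where

-- Let f₁, f₂, f₃ be pairwise orthogonal vectors of odd norms N_t = Q(f_t) on whose supports β is
-- constant: the basis vectors e_{j₁}, e_{j₂}, e_{j₃}, or, in case (3), e_{j₁}, e_{j₂} + e_{j₄}, e_{j₃}.
-- Then u = N₂ f₁ - N₁ f₂ and v = N₃ f₁ - N₁ f₃ lie in L_{a,β}, with Q(u) = N₁N₂(N₁ + N₂),
-- B(u,v) = N₁N₂N₃ and Q(v) = N₁N₃(N₁ + N₃), so Q(s u + v) = 2 (P s² + q s + R) with
-- 2P = Q(u), q = B(u,v) odd and 2R = Q(v).
-- Because the derivative 2Ps + q is odd, Newton's iteration lifts a root of P s² + q s + R = y
-- modulo 2 to a root in ℤ₂ (Hensel's lemma).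
-- If N₁ + N₂ ≡ 0 (mod 4), then P is even and every y has a root modulo 2: the lattice is even universal.
-- If N₁ ≡ N₃ (mod 4), then R is odd and every odd y has the root 0 modulo 2; scaling u and v by 2^r
-- then reaches every 2^(2r+1)·unit.

open import Defs
open import Data.Nat as ℕ using (ℕ; zero; suc; _%_; s≤s)
open import Data.Nat.DivMod using (m≡m%n+[m/n]*n; m%n<n; %-distribˡ-+; m∣n⇒o%n%m≡o%m)
import Data.Nat.Divisibility as ℕ
import Data.Nat.Properties as ℕ
open import Data.Nat.Tactic.RingSolver renaming (solve-∀ to ℕ-solve-∀)
open import Data.Integer using (ℤ; +_; _+_; _*_; _-_; -_)
open import Data.Integer.Properties
  using (pos-*; +-identityˡ; +-identityʳ; *-identityˡ; *-identityʳ; *-zeroʳ; *-comm; *-assoc;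
         *-distribˡ-+; i≡j⇒i-j≡0; +-*-semiring)
open import Data.Integer.DivMod using (_%ℕ_; _/ℕ_; a≡a%ℕn+[a/ℕn]*n; n%ℕd<d)
open import Data.Integer.Divisibility.Signed
  using (_∣_; divides; ∣ᵤ⇒∣; ∣⇒∣ᵤ; ∣-refl; ∣-trans; ∣m∣n⇒∣m+n; ∣m∣n⇒∣m-n; ∣m⇒∣-m;
         ∣m⇒∣m*n; ∣n⇒∣m*n; *-monoˡ-∣; *-monoʳ-∣)
open import Data.Integer.Tactic.RingSolver using (solve-∀)
open import Algebra.Properties.Semiring.Sum +-*-semiring
  using (sum; sum-cong-≗; ∑-distrib-+; *-distribˡ-sum; sum-replicate-zero)
open import Data.Fin using (Fin)
open import Data.Product using (Σ-syntax; _×_; _,_; proj₁; proj₂)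
open import Data.Sum using (_⊎_; inj₁; inj₂; [_,_]′)
open import Data.Empty using (⊥-elim)
open import Level using (0ℓ)
open import Relation.Nullary using (¬_)
open import Relation.Binary.Bundles using (Setoid)
import Relation.Binary.Reasoning.Setoid as ≈-Reasoning
open import Relation.Binary.PropositionalEquality
  using (_≡_; _≢_; refl; sym; trans; cong; cong₂; subst; subst₂; ≢-sym; module ≡-Reasoning)

Odd : ℤ → Set
Odd x = + 2 ∣ x - + 1

∣-%-residue : ∀ m n .{{_ : ℕ.NonZero n}} → + n ∣ + m - + (m % n)
∣-%-residue m n = divides (+ (m ℕ./ n)) (begin
  + m - + (m % n)                              ≡⟨ cong (λ x → + x - + (m % n)) (m≡m%n+[m/n]*n m n) ⟩
  + (m % n) + + (m ℕ./ n ℕ.* n) - + (m % n)    ≡⟨ cong (λ x → + (m % n) + x - + (m % n)) (pos-* (m ℕ./ n) n) ⟩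
  + (m % n) + + (m ℕ./ n) * + n - + (m % n)    ≡⟨ cancel (+ (m % n)) (+ (m ℕ./ n) * + n) ⟩
  + (m ℕ./ n) * + n                            ∎)
  where
  open ≡-Reasoning
  cancel : ∀ r x → r + x - r ≡ x
  cancel = solve-∀

∣-of-%≡ : ∀ m n r .{{_ : ℕ.NonZero n}} → m % n ≡ r → + n ∣ + m - + r
∣-of-%≡ m n r m%n≡r = subst (λ r → + n ∣ + m - + r) m%n≡r (∣-%-residue m n)

∣-of-%≡0 : ∀ m n .{{_ : ℕ.NonZero n}} → m % n ≡ 0 → + n ∣ + m
∣-of-%≡0 m n m%n≡0 = subst (+ n ∣_) (+-identityʳ (+ m)) (∣-of-%≡ m n 0 m%n≡0)

odd-of-% : ∀ m → m % 2 ≡ 1 → Odd (+ m)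
odd-of-% m = ∣-of-%≡ m 2 1

%4-%2 : ∀ m → m % 4 % 2 ≡ m % 2
%4-%2 m = m∣n⇒o%n%m≡o%m 2 4 m (ℕ.divides 2 refl)

odd-%4 : ∀ m → m % 2 ≡ 1 → m % 4 ≡ 1 ⊎ m % 4 ≡ 3
odd-%4 m m-odd = residues (m % 4) (m%n<n m 4) (trans (%4-%2 m) m-odd)
  where
  residues : ∀ r → r ℕ.< 4 → r % 2 ≡ 1 → r ≡ 1 ⊎ r ≡ 3
  residues 1 _ _ = inj₁ refl
  residues 3 _ _ = inj₂ refl
  residues (suc (suc (suc (suc _)))) (s≤s (s≤s (s≤s (s≤s ())))) _

odd+odd-%4-distinct : ∀ m n → m % 2 ≡ 1 → n % 2 ≡ 1 → m % 4 ≢ n % 4 → (m ℕ.+ n) % 4 ≡ 0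
odd+odd-%4-distinct m n m-odd n-odd m≢n =
  trans (%-distribˡ-+ m n 4) (residue-sum (odd-%4 m m-odd) (odd-%4 n n-odd))
  where
  residue-sum : m % 4 ≡ 1 ⊎ m % 4 ≡ 3 → n % 4 ≡ 1 ⊎ n % 4 ≡ 3 → (m % 4 ℕ.+ n % 4) % 4 ≡ 0
  residue-sum (inj₁ m1) (inj₁ n1) = ⊥-elim (m≢n (trans m1 (sym n1)))
  residue-sum (inj₂ m3) (inj₂ n3) = ⊥-elim (m≢n (trans m3 (sym n3)))
  residue-sum (inj₁ m1) (inj₂ n3) rewrite m1 | n3 = refl
  residue-sum (inj₂ m3) (inj₁ n1) rewrite m3 | n1 = refl

odd+odd-%4-equal : ∀ m n → m % 2 ≡ 1 → n % 2 ≡ 1 → m % 4 ≡ n % 4 → (m ℕ.+ n) % 4 ≡ 2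
odd+odd-%4-equal m n m-odd n-odd m≡n = trans (%-distribˡ-+ m n 4) (residue-sum (odd-%4 m m-odd))
  where
  residue-sum : m % 4 ≡ 1 ⊎ m % 4 ≡ 3 → (m % 4 ℕ.+ n % 4) % 4 ≡ 2
  residue-sum (inj₁ m1) rewrite sym m≡n | m1 = refl
  residue-sum (inj₂ m3) rewrite sym m≡n | m3 = refl

two+two-%4 : ∀ m n → m % 4 ≡ 2 → n % 4 ≡ 2 → (m ℕ.+ n) % 4 ≡ 0
two+two-%4 m n m2 n2 = trans (%-distribˡ-+ m n 4) (cong₂ (λ x y → (x ℕ.+ y) % 4) m2 n2)

odd+two-%2 : ∀ m n → m % 2 ≡ 1 → n % 4 ≡ 2 → (m ℕ.+ n) % 2 ≡ 1
odd+two-%2 m n m-odd n2 =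
  trans (%-distribˡ-+ m n 2) (cong₂ (λ x y → (x ℕ.+ y) % 2) m-odd (trans (sym (%4-%2 n)) (cong (_% 2) n2)))

odd-* : ∀ x y → Odd x → Odd y → Odd (x * y)
odd-* x y x-odd y-odd = subst (+ 2 ∣_) (identity x y) (∣m∣n⇒∣m+n (∣m⇒∣m*n y x-odd) y-odd)
  where
  identity : ∀ x y → (x - + 1) * y + (y - + 1) ≡ x * y - + 1
  identity = solve-∀

odd+odd-even : ∀ x y → Odd x → Odd y → + 2 ∣ x + y
odd+odd-even x y x-odd y-odd = subst (+ 2 ∣_) (identity x y) (∣m∣n⇒∣m+n (∣m∣n⇒∣m+n x-odd y-odd) ∣-refl)
  where
  identity : ∀ x y → (x - + 1) + (y - + 1) + + 2 ≡ x + y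
  identity = solve-∀

odd-*-≡2-mod4 : ∀ x y → Odd x → + 4 ∣ y - + 2 → + 4 ∣ x * y - + 2
odd-*-≡2-mod4 x y x-odd 4∣y-2 =
  subst (+ 4 ∣_) (identity x y) (∣m∣n⇒∣m+n (∣n⇒∣m*n x 4∣y-2) (*-monoʳ-∣ (+ 2) x-odd))
  where
  identity : ∀ x y → x * (y - + 2) + + 2 * (x - + 1) ≡ x * y - + 2
  identity = solve-∀

parity : ∀ x → + 2 ∣ x ⊎ Odd x
parity x with x %ℕ 2 | x /ℕ 2 | a≡a%ℕn+[a/ℕn]*n x 2 | n%ℕd<d x 2
... | 0 | q | x≡2q   | _ = inj₁ (divides q (trans x≡2q (+-identityˡ (q * + 2))))
... | 1 | q | x≡1+2q | _ = inj₂ (divides q (trans (cong (_- + 1) x≡1+2q) (cancel (q * + 2))))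
  where
  cancel : ∀ y → + 1 + y - + 1 ≡ y
  cancel = solve-∀
... | suc (suc _) | _ | _ | s≤s (s≤s ())

2∤1 : ¬ (+ 2 ∣ + 1)
2∤1 2∣1 with ℕ.∣1⇒≡1 (∣⇒∣ᵤ 2∣1)
... | ()

∣-*-∣ : ∀ {i j m n} → i ∣ m → j ∣ n → i * j ∣ m * n
∣-*-∣ {i} {j} {m} {n} i∣m j∣n = ∣-trans (*-monoʳ-∣ i j∣n) (*-monoˡ-∣ n i∣m)

pow2 : ℕ → ℤ
pow2 k = + (2 ℕ.^ k)

pow2-suc : ∀ k → pow2 (suc k) ≡ + 2 * pow2 k
pow2-suc k = pos-* 2 (2 ℕ.^ k)

pow2-∣-suc : ∀ k → pow2 k ∣ pow2 (suc k)
pow2-∣-suc k = divides (+ 2) (pow2-suc k)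

2∣pow2-suc : ∀ k → + 2 ∣ pow2 (suc k)
2∣pow2-suc k = divides (pow2 k) (trans (pow2-suc k) (*-comm (+ 2) (pow2 k)))

pow2-odd : ∀ m → m % 2 ≡ 1 → + (2 ℕ.^ m) ≡ pow2 (m ℕ./ 2) * pow2 (m ℕ./ 2) * + 2
pow2-odd m m-odd = begin
  + (2 ℕ.^ m)                    ≡⟨ cong (λ n → + (2 ℕ.^ n)) m≡1+r*2 ⟩
  + (2 ℕ.* 2 ℕ.^ (r ℕ.* 2))      ≡⟨ cong (λ n → + (2 ℕ.* n)) (sym (ℕ.^-*-assoc 2 r 2)) ⟩
  + (2 ℕ.* (R ℕ.* (R ℕ.* 1)))    ≡⟨ cong +_ (rearrange R) ⟩
  + (R ℕ.* R ℕ.* 2)              ≡⟨ pos-* (R ℕ.* R) 2 ⟩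
  + (R ℕ.* R) * + 2              ≡⟨ cong (_* + 2) (pos-* R R) ⟩
  + R * + R * + 2                ∎
  where
  open ≡-Reasoning
  r R : ℕ
  r = m ℕ./ 2
  R = 2 ℕ.^ r
  m≡1+r*2 : m ≡ 1 ℕ.+ r ℕ.* 2
  m≡1+r*2 = trans (m≡m%n+[m/n]*n m 2) (cong (ℕ._+ r ℕ.* 2) m-odd)
  rearrange : ∀ R → 2 ℕ.* (R ℕ.* (R ℕ.* 1)) ≡ R ℕ.* R ℕ.* 2
  rearrange = ℕ-solve-∀

≈₂-level : ∀ x y → x ≈₂ y → ∀ k → pow2 k ∣ x k - y k
≈₂-level x y x≈y k = ∣ᵤ⇒∣ {pow2 k} {x k - y k} (x≈y k)

coh-level : ∀ t k → pow2 k ∣ seq t (suc k) - seq t k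
coh-level t = ≈₂-level (λ k → seq t (suc k)) (seq t) (coh t)

≈₂-reflexive : {x y : Seq} → (∀ k → x k ≡ y k) → x ≈₂ y
≈₂-reflexive {x} {y} x≡y k = ∣⇒∣ᵤ (subst (pow2 k ∣_) (sym (i≡j⇒i-j≡0 (x≡y k))) (divides (+ 0) refl))

≈₂-sym : {x y : Seq} → x ≈₂ y → y ≈₂ x
≈₂-sym {x} {y} x≈y k = ∣⇒∣ᵤ (subst (pow2 k ∣_) (flip (x k) (y k)) (∣m⇒∣-m (≈₂-level x y x≈y k)))
  where
  flip : ∀ a b → - (a - b) ≡ b - a
  flip = solve-∀

≈₂-trans : {x y z : Seq} → x ≈₂ y → y ≈₂ z → x ≈₂ z
≈₂-trans {x} {y} {z} x≈y y≈z k = ∣⇒∣ᵤ (subst (pow2 k ∣_) (telescope (x k) (y k) (z k))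
  (∣m∣n⇒∣m+n (≈₂-level x y x≈y k) (≈₂-level y z y≈z k)))
  where
  telescope : ∀ a b c → (a - b) + (b - c) ≡ a - c
  telescope = solve-∀

≈₂-*ˡ : ∀ c x y → x ≈₂ y → (const₂ c *ₛ x) ≈₂ (const₂ c *ₛ y)
≈₂-*ˡ c x y x≈y k = ∣⇒∣ᵤ (subst (pow2 k ∣_) (sym (*-distribˡ-minus c (x k) (y k)))
  (∣n⇒∣m*n c (≈₂-level x y x≈y k)))
  where
  *-distribˡ-minus : ∀ c a b → c * a - c * b ≡ c * (a - b)
  *-distribˡ-minus = solve-∀

≈₂-setoid : Setoid 0ℓ 0ℓ
≈₂-setoid = record
  { Carrier       = Seq
  ; _≈_           = _≈₂_
  ; isEquivalence = record
    { refl  = λ {x} → ≈₂-reflexive {x} {x} (λ _ → refl)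
    ; sym   = λ {x} {y} → ≈₂-sym {x} {y}
    ; trans = λ {x} {y} {z} → ≈₂-trans {x} {y} {z}
    }
  }

unit-odd : ∀ u → Unit₂ u → Odd (seq u 1)
unit-odd u (v , uv≈1) with parity (seq u 1)
... | inj₂ u₁-odd = u₁-odd
... | inj₁ 2∣u₁   = ⊥-elim (2∤1 (subst (+ 2 ∣_) (difference u₁ v₁) (∣m∣n⇒∣m-n (∣m⇒∣m*n v₁ 2∣u₁) 2∣u₁v₁-1)))
  where
  u₁ v₁ : ℤ
  u₁ = seq u 1
  v₁ = seq v 1
  2∣u₁v₁-1 : + 2 ∣ u₁ * v₁ - + 1
  2∣u₁v₁-1 = ≈₂-level (seq u *ₛ seq v) (const₂ (+ 1)) uv≈1 1
  difference : ∀ x y → x * y - (x * y - + 1) ≡ + 1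
  difference = solve-∀

quad : ℤ → ℤ → ℤ → ℤ → ℤ
quad p q r s = p * s * s + q * s + r

-- With D = t - f(s), one has t - f(s + D) = -(f′(s) - 1) D - p D², and f′(s) = 2ps + q is odd,
-- so the error term gains one factor of 2.
newton-lift : ∀ {p q r} → Odd q → ∀ k t s → pow2 (suc k) ∣ t - quad p q r s →
              pow2 (suc (suc k)) ∣ t - quad p q r (s + (t - quad p q r s))
newton-lift {p} {q} {r} q-odd k t s D-small =
  subst (pow2 (suc (suc k)) ∣_) (sym (newton-identity p q r s t))
    (∣m⇒∣-m (∣m∣n⇒∣m+n linear-term quadratic-term))
  where
  D : ℤ
  D = t - quad p q r s
  newton-identity : ∀ p q r s t →
    t - (p * (s + (t - (p * s * s + q * s + r))) * (s + (t - (p * s * s + q * s + r)))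
         + q * (s + (t - (p * s * s + q * s + r))) + r)
    ≡ - ((q - + 1 + + 2 * (p * s)) * (t - (p * s * s + q * s + r))
         + p * ((t - (p * s * s + q * s + r)) * (t - (p * s * s + q * s + r))))
  newton-identity = solve-∀
  linear-term : pow2 (suc (suc k)) ∣ (q - + 1 + + 2 * (p * s)) * D
  linear-term = subst (_∣ (q - + 1 + + 2 * (p * s)) * D) (sym (pow2-suc (suc k)))
    (∣-*-∣ (∣m∣n⇒∣m+n q-odd (∣m⇒∣m*n (p * s) ∣-refl)) D-small)
  quadratic-term : pow2 (suc (suc k)) ∣ p * (D * D)
  quadratic-term = ∣n⇒∣m*n p (∣-trans
    (subst (_∣ pow2 (suc k) * pow2 (suc k)) (sym (pow2-suc (suc k))) (*-monoˡ-∣ (pow2 (suc k)) (2∣pow2-suc k)))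
    (∣-*-∣ D-small D-small))

hensel : ∀ {p q r} → Odd q → (t : ℤ₂) (s₀ : ℤ) → + 2 ∣ seq t 1 - quad p q r s₀ →
         Σ[ s ∈ ℤ₂ ] (λ k → quad p q r (seq s k)) ≈₂ seq t
hensel {p} {q} {r} q-odd t s₀ start = mkℤ₂ approx approx-coherent , root
  where
  f : ℤ → ℤ
  f = quad p q r
  approx : ℕ → ℤ
  approx-error : ∀ k → pow2 (suc k) ∣ seq t (suc k) - f (approx k)
  correction-small : ∀ k → pow2 (suc k) ∣ seq t (suc (suc k)) - f (approx k)

  approx zero    = s₀
  approx (suc k) = approx k + (seq t (suc (suc k)) - f (approx k))

  approx-error zero    = start
  approx-error (suc k) = newton-lift {p} {q} {r} q-odd k (seq t (suc (suc k))) (approx k) (correction-small k)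

  correction-small k =
    subst (pow2 (suc k) ∣_) (telescope (seq t (suc (suc k))) (seq t (suc k)) (f (approx k)))
      (∣m∣n⇒∣m+n (coh-level t (suc k)) (approx-error k))
    where
    telescope : ∀ a b c → (a - b) + (b - c) ≡ a - c
    telescope = solve-∀

  approx-coherent : Coherent approx
  approx-coherent k = ∣⇒∣ᵤ (∣-trans (pow2-∣-suc k)
    (subst (pow2 (suc k) ∣_) (sym (step (approx k) _)) (correction-small k)))
    where
    step : ∀ a d → a + d - a ≡ d
    step = solve-∀

  root : (λ k → f (approx k)) ≈₂ seq t
  root k = ∣⇒∣ᵤ (subst (pow2 k ∣_) (rearrange (seq t (suc k)) (seq t k) (f (approx k)))
    (∣m∣n⇒∣m-n (coh-level t k) (∣-trans (pow2-∣-suc k) (approx-error k))))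
    where
    rearrange : ∀ a b c → (a - b) - (a - c) ≡ c - b
    rearrange = solve-∀

Σℤ≡sum : ∀ n (f : Fin n → ℤ) → Σℤ n f ≡ sum f
Σℤ≡sum zero    f = refl
Σℤ≡sum (suc n) f = cong (λ x → f Fin.zero + x) (Σℤ≡sum n (λ i → f (Fin.suc i)))

Σℤ-cong : ∀ {n} {f g : Fin n → ℤ} → (∀ i → f i ≡ g i) → Σℤ n f ≡ Σℤ n g
Σℤ-cong {n} {f} {g} f≗g = trans (Σℤ≡sum n f) (trans (sum-cong-≗ f≗g) (sym (Σℤ≡sum n g)))

Σℤ-distrib-+ : ∀ {n} (f g : Fin n → ℤ) → Σℤ n (λ i → f i + g i) ≡ Σℤ n f + Σℤ n g
Σℤ-distrib-+ {n} f g = begin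
  Σℤ n (λ i → f i + g i)  ≡⟨ Σℤ≡sum n (λ i → f i + g i) ⟩
  sum (λ i → f i + g i)   ≡⟨ ∑-distrib-+ f g ⟩
  sum f + sum g           ≡⟨ cong₂ _+_ (Σℤ≡sum n f) (Σℤ≡sum n g) ⟨
  Σℤ n f + Σℤ n g         ∎
  where open ≡-Reasoning

*-distribˡ-Σℤ : ∀ {n} c (f : Fin n → ℤ) → c * Σℤ n f ≡ Σℤ n (λ i → c * f i)
*-distribˡ-Σℤ {n} c f = begin
  c * Σℤ n f              ≡⟨ cong (c *_) (Σℤ≡sum n f) ⟩
  c * sum f               ≡⟨ *-distribˡ-sum c f ⟩
  sum (λ i → c * f i)     ≡⟨ Σℤ≡sum n (λ i → c * f i) ⟨
  Σℤ n (λ i → c * f i)    ∎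
  where open ≡-Reasoning

e : ∀ {n} → Fin n → Fin n → ℤ
e Fin.zero    Fin.zero    = + 1
e Fin.zero    (Fin.suc i) = + 0
e (Fin.suc j) Fin.zero    = + 0
e (Fin.suc j) (Fin.suc i) = e j i

e-diag : ∀ {n} (j : Fin n) → e j j ≡ + 1
e-diag Fin.zero    = refl
e-diag (Fin.suc j) = e-diag j

e-off : ∀ {n} {i j : Fin n} → i ≢ j → e i j ≡ + 0
e-off {i = Fin.zero}  {Fin.zero}  i≢j = ⊥-elim (i≢j refl)
e-off {i = Fin.zero}  {Fin.suc j} i≢j = refl
e-off {i = Fin.suc i} {Fin.zero}  i≢j = refl
e-off {i = Fin.suc i} {Fin.suc j} i≢j = e-off (λ i≡j → i≢j (cong Fin.suc i≡j))

Σℤ-*-e : ∀ {n} (f : Fin n → ℤ) j → Σℤ n (λ i → f i * e j i) ≡ f j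
Σℤ-*-e {suc n} f Fin.zero = begin
  f₀ * + 1 + Σℤ n (λ i → f (Fin.suc i) * + 0)
    ≡⟨ cong₂ _+_ (*-identityʳ f₀) (Σℤ-cong (λ i → *-zeroʳ (f (Fin.suc i)))) ⟩
  f₀ + Σℤ n (λ _ → + 0)
    ≡⟨ cong (λ x → f₀ + x) (trans (Σℤ≡sum n (λ _ → + 0)) (sum-replicate-zero n)) ⟩
  f₀ + + 0
    ≡⟨ +-identityʳ f₀ ⟩
  f₀ ∎
  where
  open ≡-Reasoning
  f₀ : ℤ
  f₀ = f Fin.zero
Σℤ-*-e {suc n} f (Fin.suc j) = begin
  f Fin.zero * + 0 + Σℤ n (λ i → f (Fin.suc i) * e j i)
    ≡⟨ cong₂ _+_ (*-zeroʳ (f Fin.zero)) (Σℤ-*-e (λ i → f (Fin.suc i)) j) ⟩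
  + 0 + f (Fin.suc j)
    ≡⟨ +-identityˡ (f (Fin.suc j)) ⟩
  f (Fin.suc j) ∎
  where open ≡-Reasoning

ℤ¹⁰ : Set
ℤ¹⁰ = Fin 10 → ℤ

infixl 6 _+ᵥ_
infixr 7 _•_

_+ᵥ_ : ℤ¹⁰ → ℤ¹⁰ → ℤ¹⁰
(x +ᵥ y) i = x i + y i

_•_ : ℤ → ℤ¹⁰ → ℤ¹⁰
(c • x) i = c * x i

Qℤ : (Fin 10 → ℕ) → ℤ¹⁰ → ℤ
Qℤ a x = Bℤ a x x

module _ (a : Fin 10 → ℕ) where

  B-sym : ∀ x y → Bℤ a x y ≡ Bℤ a y x
  B-sym x y = Σℤ-cong (λ i → swap (+ a i) (x i) (y i))
    where
    swap : ∀ A X Y → A * X * Y ≡ A * Y * X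
    swap = solve-∀

  B-+ʳ : ∀ x y z → Bℤ a x (y +ᵥ z) ≡ Bℤ a x y + Bℤ a x z
  B-+ʳ x y z = trans (Σℤ-cong (λ i → *-distribˡ-+ (+ a i * x i) (y i) (z i)))
                     (Σℤ-distrib-+ (λ i → + a i * x i * y i) (λ i → + a i * x i * z i))

  B-•ʳ : ∀ x c y → Bℤ a x (c • y) ≡ c * Bℤ a x y
  B-•ʳ x c y = trans (Σℤ-cong (λ i → pull (+ a i * x i) c (y i)))
                     (sym (*-distribˡ-Σℤ c (λ i → + a i * x i * y i)))
    where
    pull : ∀ A c Y → A * (c * Y) ≡ c * (A * Y)
    pull = solve-∀

  B-+ˡ : ∀ x y z → Bℤ a (x +ᵥ y) z ≡ Bℤ a x z + Bℤ a y z
  B-+ˡ x y z = trans (B-sym (x +ᵥ y) z) (trans (B-+ʳ z x y) (cong₂ _+_ (B-sym z x) (B-sym z y)))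

  B-affineʳ : ∀ x s u v → Bℤ a x (s • u +ᵥ v) ≡ s * Bℤ a x u + Bℤ a x v
  B-affineʳ x s u v = trans (B-+ʳ x (s • u) v) (cong (_+ Bℤ a x v) (B-•ʳ x s u))

  B-combʳ : ∀ x c y d z → Bℤ a x (c • y +ᵥ d • z) ≡ c * Bℤ a x y + d * Bℤ a x z
  B-combʳ x c y d z = trans (B-affineʳ x c y (d • z)) (cong (λ p → c * Bℤ a x y + p) (B-•ʳ x d z))

  B-combˡ : ∀ c x d y z → Bℤ a (c • x +ᵥ d • y) z ≡ c * Bℤ a x z + d * Bℤ a y z
  B-combˡ c x d y z = begin
    Bℤ a (c • x +ᵥ d • y) z          ≡⟨ B-sym (c • x +ᵥ d • y) z ⟩
    Bℤ a z (c • x +ᵥ d • y)          ≡⟨ B-combʳ z c x d y ⟩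
    c * Bℤ a z x + d * Bℤ a z y      ≡⟨ cong₂ (λ p q → c * p + d * q) (B-sym z x) (B-sym z y) ⟩
    c * Bℤ a x z + d * Bℤ a y z      ∎
    where open ≡-Reasoning

  B-scale : ∀ c x y → Bℤ a (c • x) (c • y) ≡ c * c * Bℤ a x y
  B-scale c x y = begin
    Bℤ a (c • x) (c • y)             ≡⟨ B-•ʳ (c • x) c y ⟩
    c * Bℤ a (c • x) y               ≡⟨ cong (c *_) (trans (B-sym (c • x) y) (B-•ʳ y c x)) ⟩
    c * (c * Bℤ a y x)               ≡⟨ cong (λ p → c * (c * p)) (B-sym y x) ⟩
    c * (c * Bℤ a x y)               ≡⟨ *-assoc c c (Bℤ a x y) ⟨
    c * c * Bℤ a x y                 ∎
    where open ≡-Reasoning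

  Q-affine : ∀ s u v → Qℤ a (s • u +ᵥ v) ≡ s * s * Qℤ a u + + 2 * s * Bℤ a u v + Qℤ a v
  Q-affine s u v = begin
    Bℤ a w w
      ≡⟨ B-affineʳ w s u v ⟩
    s * Bℤ a w u + Bℤ a w v
      ≡⟨ cong₂ (λ p q → s * p + q) (B-sym w u) (B-sym w v) ⟩
    s * Bℤ a u w + Bℤ a v w
      ≡⟨ cong₂ (λ p q → s * p + q) (B-affineʳ u s u v) (B-affineʳ v s u v) ⟩
    s * (s * Qℤ a u + Bℤ a u v) + (s * Bℤ a v u + Qℤ a v)
      ≡⟨ cong (λ p → s * (s * Qℤ a u + Bℤ a u v) + (s * p + Qℤ a v)) (B-sym v u) ⟩
    s * (s * Qℤ a u + Bℤ a u v) + (s * Bℤ a u v + Qℤ a v)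
      ≡⟨ collect s (Qℤ a u) (Bℤ a u v) (Qℤ a v) ⟩
    s * s * Qℤ a u + + 2 * s * Bℤ a u v + Qℤ a v ∎
    where
    open ≡-Reasoning
    w : ℤ¹⁰
    w = s • u +ᵥ v
    collect : ∀ s Q B Q′ → s * (s * Q + B) + (s * B + Q′) ≡ s * s * Q + + 2 * s * B + Q′
    collect = solve-∀

  Q-+-orthogonal : ∀ f g → Bℤ a f g ≡ + 0 → Qℤ a (f +ᵥ g) ≡ Qℤ a f + Qℤ a g
  Q-+-orthogonal f g f⊥g = begin
    Bℤ a (f +ᵥ g) (f +ᵥ g)
      ≡⟨ B-+ʳ (f +ᵥ g) f g ⟩
    Bℤ a (f +ᵥ g) f + Bℤ a (f +ᵥ g) g
      ≡⟨ cong₂ _+_ (B-+ˡ f g f) (B-+ˡ f g g) ⟩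
    (Qℤ a f + Bℤ a g f) + (Bℤ a f g + Qℤ a g)
      ≡⟨ cong₂ (λ p q → (Qℤ a f + p) + (q + Qℤ a g)) (trans (B-sym g f) f⊥g) f⊥g ⟩
    (Qℤ a f + + 0) + (+ 0 + Qℤ a g)
      ≡⟨ drop-zeros (Qℤ a f) (Qℤ a g) ⟩
    Qℤ a f + Qℤ a g ∎
    where
    open ≡-Reasoning
    drop-zeros : ∀ p q → (p + + 0) + (+ 0 + q) ≡ p + q
    drop-zeros = solve-∀

  B-orthogonal-combination : ∀ c f d g c′ d′ h → Bℤ a f g ≡ + 0 → Bℤ a f h ≡ + 0 →
    Bℤ a (c • f +ᵥ d • g) (c′ • f +ᵥ d′ • h) ≡ c * c′ * Qℤ a f + d * d′ * Bℤ a g h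
  B-orthogonal-combination c f d g c′ d′ h f⊥g f⊥h = begin
    Bℤ a x (c′ • f +ᵥ d′ • h)
      ≡⟨ B-combʳ x c′ f d′ h ⟩
    c′ * Bℤ a x f + d′ * Bℤ a x h
      ≡⟨ cong₂ (λ p q → c′ * p + d′ * q) (B-combˡ c f d g f) (B-combˡ c f d g h) ⟩
    c′ * (c * Qℤ a f + d * Bℤ a g f) + d′ * (c * Bℤ a f h + d * Bℤ a g h)
      ≡⟨ cong₂ (λ p q → c′ * (c * Qℤ a f + d * p) + d′ * (c * q + d * Bℤ a g h)) (trans (B-sym g f) f⊥g) f⊥h ⟩
    c′ * (c * Qℤ a f + d * + 0) + d′ * (c * + 0 + d * Bℤ a g h)
      ≡⟨ collect c d c′ d′ (Qℤ a f) (Bℤ a g h) ⟩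
    c * c′ * Qℤ a f + d * d′ * Bℤ a g h ∎
    where
    open ≡-Reasoning
    x : ℤ¹⁰
    x = c • f +ᵥ d • g
    collect : ∀ c d c′ d′ Q B → c′ * (c * Q + d * + 0) + d′ * (c * + 0 + d * B) ≡ c * c′ * Q + d * d′ * B
    collect = solve-∀

  B-eʳ : ∀ x j → Bℤ a x (e j) ≡ + a j * x j
  B-eʳ x j = Σℤ-*-e (λ i → + a i * x i) j

  Q-e : ∀ j → Qℤ a (e j) ≡ + a j
  Q-e j = trans (B-eʳ (e j) j) (trans (cong (+ a j *_) (e-diag j)) (*-identityʳ (+ a j)))

  e-orthogonal : ∀ {i j} → i ≢ j → Bℤ a (e i) (e j) ≡ + 0
  e-orthogonal {i} {j} i≢j = trans (B-eʳ (e i) j) (trans (cong (+ a j *_) (e-off i≢j)) (*-zeroʳ (+ a j)))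

InL : (Fin 10 → ℕ) → ℤ¹⁰ → ℤ¹⁰ → Set
InL a β x = Bℤ a αℤ x ≡ + 0 × Bℤ a β x ≡ + 0

InL-• : ∀ a {β u} → InL a β u → ∀ c → InL a β (c • u)
InL-• a {β} {u} (αu , βu) c = orthogonal αℤ αu , orthogonal β βu
  where
  orthogonal : ∀ y → Bℤ a y u ≡ + 0 → Bℤ a y (c • u) ≡ + 0
  orthogonal y yu = trans (B-•ʳ a y c u) (trans (cong (c *_) yu) (*-zeroʳ c))

InL-affine : ∀ a {β u v} → InL a β u → InL a β v → ∀ s → InL a β (s • u +ᵥ v)
InL-affine a {β} {u} {v} (αu , βu) (αv , βv) s = orthogonal αℤ αu αv , orthogonal β βu βv
  where
  vanish : ∀ s → s * + 0 + + 0 ≡ + 0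
  vanish = solve-∀
  orthogonal : ∀ y → Bℤ a y u ≡ + 0 → Bℤ a y v ≡ + 0 → Bℤ a y (s • u +ᵥ v) ≡ + 0
  orthogonal y yu yv = trans (B-affineʳ a y s u v) (trans (cong₂ (λ p q → s * p + q) yu yv) (vanish s))

affine-point : ℤ₂ → ℤ¹⁰ → ℤ¹⁰ → Fin 10 → ℤ₂
affine-point s u v i = mkℤ₂ (λ k → seq s k * u i + v i) coherent
  where
  coherent : Coherent (λ k → seq s k * u i + v i)
  coherent k = ∣⇒∣ᵤ (subst (pow2 k ∣_) (sym (shift (seq s (suc k)) (seq s k) (u i) (v i)))
                                        (∣m⇒∣m*n (u i) (coh-level s k)))
    where
    shift : ∀ s′ s u v → (s′ * u + v) - (s * u + v) ≡ (s′ - s) * u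
    shift = solve-∀

represents-of-affine : ∀ {a β u v} → InL a β u → InL a β v → (s c : ℤ₂) →
  (λ k → Qℤ a (seq s k • u +ᵥ v)) ≈₂ seq c → Represents a β c
represents-of-affine {a} {β} {u} {v} u∈L v∈L s c Q≈c =
  affine-point s u v , ≈₂-reflexive (λ k → proj₁ (w∈L k)) , ≈₂-reflexive (λ k → proj₂ (w∈L k)) , Q≈c
  where
  w∈L : ∀ k → InL a β (seq s k • u +ᵥ v)
  w∈L k = InL-affine a {β} {u} {v} u∈L v∈L (seq s k)

binary-represents : ∀ {a β u v P R} → InL a β u → InL a β v →
  Qℤ a u ≡ + 2 * P → Qℤ a v ≡ + 2 * R → Odd (Bℤ a u v) →
  ∀ μ y s₀ → + 2 ∣ seq y 1 - quad P (Bℤ a u v) R s₀ →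
  ∀ c → seq c ≈₂ (const₂ (μ * μ * + 2) *ₛ seq y) → Represents a β c
binary-represents {a} {β} {u} {v} {P} {R} u∈L v∈L Qu≡2P Qv≡2R q-odd μ y s₀ start c c≈ =
  represents-of-affine {a} {β} {μ • u} {μ • v} (InL-• a {β} {u} u∈L μ) (InL-• a {β} {v} v∈L μ) s c Q≈c
  where
  q : ℤ
  q = Bℤ a u v
  solution : Σ[ s ∈ ℤ₂ ] (λ k → quad P q R (seq s k)) ≈₂ seq y
  solution = hensel {P} {q} {R} q-odd y s₀ start
  s : ℤ₂
  s = proj₁ solution
  Q-scaled : ∀ k → Qℤ a (seq s k • μ • u +ᵥ μ • v) ≡ μ * μ * + 2 * quad P q R (seq s k)
  Q-scaled k = begin
    Qℤ a (S • μ • u +ᵥ μ • v)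
      ≡⟨ Q-affine a S (μ • u) (μ • v) ⟩
    S * S * Qℤ a (μ • u) + + 2 * S * Bℤ a (μ • u) (μ • v) + Qℤ a (μ • v)
      ≡⟨ cong₂ (λ p r → S * S * p + + 2 * S * Bℤ a (μ • u) (μ • v) + r) (B-scale a μ u u) (B-scale a μ v v) ⟩
    S * S * (μ * μ * Qℤ a u) + + 2 * S * Bℤ a (μ • u) (μ • v) + μ * μ * Qℤ a v
      ≡⟨ cong (λ p → S * S * (μ * μ * Qℤ a u) + + 2 * S * p + μ * μ * Qℤ a v) (B-scale a μ u v) ⟩
    S * S * (μ * μ * Qℤ a u) + + 2 * S * (μ * μ * q) + μ * μ * Qℤ a v
      ≡⟨ cong₂ (λ p r → S * S * (μ * μ * p) + + 2 * S * (μ * μ * q) + μ * μ * r) Qu≡2P Qv≡2R ⟩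
    S * S * (μ * μ * (+ 2 * P)) + + 2 * S * (μ * μ * q) + μ * μ * (+ 2 * R)
      ≡⟨ factor S μ P q R ⟩
    μ * μ * + 2 * quad P q R S ∎
    where
    open ≡-Reasoning
    S : ℤ
    S = seq s k
    factor : ∀ S μ P q R → S * S * (μ * μ * (+ 2 * P)) + + 2 * S * (μ * μ * q) + μ * μ * (+ 2 * R)
                           ≡ μ * μ * + 2 * (P * S * S + q * S + R)
    factor = solve-∀
  Q≈c : (λ k → Qℤ a (seq s k • μ • u +ᵥ μ • v)) ≈₂ seq c
  Q≈c = begin
    (λ k → Qℤ a (seq s k • μ • u +ᵥ μ • v))              ≈⟨ ≈₂-reflexive Q-scaled ⟩
    const₂ (μ * μ * + 2) *ₛ (λ k → quad P q R (seq s k))  ≈⟨ ≈₂-*ˡ (μ * μ * + 2) _ (seq y) (proj₂ solution) ⟩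
    const₂ (μ * μ * + 2) *ₛ seq y                         ≈⟨ c≈ ⟨
    seq c                                                 ∎
    where open ≈-Reasoning ≈₂-setoid

binary-evenUniversal : ∀ {a β u v} → InL a β u → InL a β v →
  + 4 ∣ Qℤ a u → Odd (Bℤ a u v) → + 2 ∣ Qℤ a v → EvenUniversal a β
binary-evenUniversal {a} {β} {u} {v} u∈L v∈L (divides P Qu≡4P) q-odd (divides R Qv≡2R) c (y , c≈2y) =
  binary-represents {a} {β} {u} {v} {P * + 2} {R} u∈L v∈L
    (trans Qu≡4P (regroup P)) (trans Qv≡2R (*-comm R (+ 2))) q-odd (+ 1) y (seq y 1 - R) start c c≈2y
  where
  q : ℤ
  q = Bℤ a u v
  regroup : ∀ P → P * + 4 ≡ + 2 * (P * + 2)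
  regroup = solve-∀
  -- Modulo 2 the quadratic is s + R (2P is even and q odd), so s₀ = y₁ - R is a root.
  start : + 2 ∣ seq y 1 - quad (P * + 2) q R (seq y 1 - R)
  start = subst (+ 2 ∣_) (sym (residual (seq y 1) R P q))
    (∣m⇒∣-m (∣m∣n⇒∣m+n (∣n⇒∣m*n (seq y 1 - R) q-odd) (∣n⇒∣m*n (P * ((seq y 1 - R) * (seq y 1 - R))) ∣-refl)))
    where
    residual : ∀ y R P q → y - ((P * + 2) * (y - R) * (y - R) + q * (y - R) + R)
                           ≡ - ((y - R) * (q - + 1) + P * ((y - R) * (y - R)) * + 2)
    residual = solve-∀

binary-representsOddOrder : ∀ {a β u v} → InL a β u → InL a β v →
  + 2 ∣ Qℤ a u → Odd (Bℤ a u v) → + 4 ∣ Qℤ a v - + 2 → RepresentsOddOrder a β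
binary-representsOddOrder {a} {β} {u} {v} u∈L v∈L (divides P Qu≡2P) q-odd (divides R′ Qv-2≡4R′)
                          c (m , w , m-odd , w-unit , c≈2^mw) =
  binary-represents {a} {β} {u} {v} {P} {R} u∈L v∈L (trans Qu≡2P (*-comm P (+ 2))) Qv≡2R q-odd
    (pow2 (m ℕ./ 2)) w (+ 0) start c (subst (λ M → seq c ≈₂ (const₂ M *ₛ seq w)) (pow2-odd m m-odd) c≈2^mw)
  where
  q R : ℤ
  q = Bℤ a u v
  R = + 1 + R′ * + 2
  Qv≡2R : Qℤ a v ≡ + 2 * R
  Qv≡2R = trans (sym (add-back (Qℤ a v))) (trans (cong (_+ + 2) Qv-2≡4R′) (regroup R′))
    where
    add-back : ∀ x → x - + 2 + + 2 ≡ x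
    add-back = solve-∀
    regroup : ∀ R′ → R′ * + 4 + + 2 ≡ + 2 * (+ 1 + R′ * + 2)
    regroup = solve-∀
  start : + 2 ∣ seq w 1 - quad P q R (+ 0)
  start = subst (+ 2 ∣_) (sym (residual (seq w 1) P q R′)) (∣m∣n⇒∣m-n (unit-odd w w-unit) (∣n⇒∣m*n R′ ∣-refl))
    where
    residual : ∀ w P q R′ → w - (P * + 0 * + 0 + q * + 0 + (+ 1 + R′ * + 2)) ≡ w - + 1 - R′ * + 2
    residual = solve-∀

-- Typically the indicator vector of a set of indices on which β takes the constant value b.
record Block (a : Fin 10 → ℕ) (β : ℤ¹⁰) (b : ℤ) (f : ℤ¹⁰) : Set where
  field
    α-block : Bℤ a αℤ f ≡ Qℤ a f
    β-block : Bℤ a β f ≡ b * Qℤ a f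
open Block

e-block : ∀ a {β b} j → β j ≡ b → Block a β b (e j)
e-block a {β} {b} j βj≡b = record
  { α-block = trans (B-eʳ a αℤ j) (trans (*-identityʳ (+ a j)) (sym (Q-e a j)))
  ; β-block = trans (B-eʳ a β j) (trans (cong (+ a j *_) βj≡b)
                (trans (*-comm (+ a j) b) (cong (b *_) (sym (Q-e a j)))))
  }

block-+ : ∀ a {β b f g} → Block a β b f → Block a β b g → Bℤ a f g ≡ + 0 → Block a β b (f +ᵥ g)
block-+ a {β} {b} {f} {g} F G f⊥g = record
  { α-block = trans (B-+ʳ a αℤ f g) (trans (cong₂ _+_ (α-block F) (α-block G)) (sym Q-f+g))
  ; β-block = trans (B-+ʳ a β f g) (trans (cong₂ _+_ (β-block F) (β-block G))
                (trans (sym (*-distribˡ-+ b (Qℤ a f) (Qℤ a g))) (cong (b *_) (sym Q-f+g))))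
  }
  where
  Q-f+g : Qℤ a (f +ᵥ g) ≡ Qℤ a f + Qℤ a g
  Q-f+g = Q-+-orthogonal a f g f⊥g

block-difference-∈L : ∀ a {β b f g} → Block a β b f → Block a β b g →
  InL a β (Qℤ a g • f +ᵥ (- Qℤ a f) • g)
block-difference-∈L a {β} {b} {f} {g} F G =
  vanishes αℤ (+ 1) (trans (α-block F) (sym (*-identityˡ (Qℤ a f))))
                    (trans (α-block G) (sym (*-identityˡ (Qℤ a g)))) ,
  vanishes β b (β-block F) (β-block G)
  where
  vanishes : ∀ y c → Bℤ a y f ≡ c * Qℤ a f → Bℤ a y g ≡ c * Qℤ a g →
             Bℤ a y (Qℤ a g • f +ᵥ (- Qℤ a f) • g) ≡ + 0
  vanishes y c yf yg =
    trans (B-combʳ a y (Qℤ a g) f (- Qℤ a f) g)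
      (trans (cong₂ (λ p q → Qℤ a g * p + - Qℤ a f * q) yf yg) (cancel (Qℤ a f) (Qℤ a g) c))
    where
    cancel : ∀ Qf Qg c → Qg * (c * Qf) + - Qf * (c * Qg) ≡ + 0
    cancel = solve-∀

record Frame (a : Fin 10 → ℕ) (β : ℤ¹⁰) : Set where
  field
    b        : ℤ
    f₁ f₂ f₃ : ℤ¹⁰
    block₁   : Block a β b f₁
    block₂   : Block a β b f₂
    block₃   : Block a β b f₃
    f₁⊥f₂    : Bℤ a f₁ f₂ ≡ + 0
    f₁⊥f₃    : Bℤ a f₁ f₃ ≡ + 0
    f₂⊥f₃    : Bℤ a f₂ f₃ ≡ + 0

module _ {a : Fin 10 → ℕ} {β : ℤ¹⁰} (F : Frame a β) where
  open Frame F

  private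
    N₁ N₂ N₃ : ℤ
    N₁ = Qℤ a f₁
    N₂ = Qℤ a f₂
    N₃ = Qℤ a f₃

    u v : ℤ¹⁰
    u = N₂ • f₁ +ᵥ (- N₁) • f₂
    v = N₃ • f₁ +ᵥ (- N₁) • f₃

    u∈L : InL a β u
    u∈L = block-difference-∈L a block₁ block₂

    v∈L : InL a β v
    v∈L = block-difference-∈L a block₁ block₃

    Q-u : Qℤ a u ≡ N₁ * N₂ * (N₁ + N₂)
    Q-u = trans (B-orthogonal-combination a N₂ f₁ (- N₁) f₂ N₂ (- N₁) f₂ f₁⊥f₂ f₁⊥f₂) (collect N₁ N₂)
      where
      collect : ∀ N₁ N₂ → N₂ * N₂ * N₁ + - N₁ * - N₁ * N₂ ≡ N₁ * N₂ * (N₁ + N₂)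
      collect = solve-∀

    Q-v : Qℤ a v ≡ N₁ * N₃ * (N₁ + N₃)
    Q-v = trans (B-orthogonal-combination a N₃ f₁ (- N₁) f₃ N₃ (- N₁) f₃ f₁⊥f₃ f₁⊥f₃) (collect N₁ N₃)
      where
      collect : ∀ N₁ N₃ → N₃ * N₃ * N₁ + - N₁ * - N₁ * N₃ ≡ N₁ * N₃ * (N₁ + N₃)
      collect = solve-∀

    B-u-v : Bℤ a u v ≡ N₁ * N₂ * N₃
    B-u-v = trans (B-orthogonal-combination a N₂ f₁ (- N₁) f₂ N₃ (- N₁) f₃ f₁⊥f₂ f₁⊥f₃)
                  (trans (cong (λ x → N₂ * N₃ * N₁ + - N₁ * - N₁ * x) f₂⊥f₃) (collect N₁ N₂ N₃))
      where
      collect : ∀ N₁ N₂ N₃ → N₂ * N₃ * N₁ + - N₁ * - N₁ * + 0 ≡ N₁ * N₂ * N₃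
      collect = solve-∀

    odd-B-u-v : Odd N₁ → Odd N₂ → Odd N₃ → Odd (Bℤ a u v)
    odd-B-u-v odd₁ odd₂ odd₃ = subst Odd (sym B-u-v) (odd-* (N₁ * N₂) N₃ (odd-* N₁ N₂ odd₁ odd₂) odd₃)

  frame-evenUniversal : Odd (Qℤ a f₁) → Odd (Qℤ a f₂) → Odd (Qℤ a f₃) →
                        + 4 ∣ Qℤ a f₁ + Qℤ a f₂ → EvenUniversal a β
  frame-evenUniversal odd₁ odd₂ odd₃ 4∣N₁+N₂ = binary-evenUniversal {a} {β} {u} {v} u∈L v∈L
    (subst (+ 4 ∣_) (sym Q-u) (∣n⇒∣m*n (N₁ * N₂) 4∣N₁+N₂))
    (odd-B-u-v odd₁ odd₂ odd₃)
    (subst (+ 2 ∣_) (sym Q-v) (∣n⇒∣m*n (N₁ * N₃) (odd+odd-even N₁ N₃ odd₁ odd₃)))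

  frame-representsOddOrder : Odd (Qℤ a f₁) → Odd (Qℤ a f₂) → Odd (Qℤ a f₃) →
                             + 4 ∣ Qℤ a f₁ + Qℤ a f₃ - + 2 → RepresentsOddOrder a β
  frame-representsOddOrder odd₁ odd₂ odd₃ 4∣N₁+N₃-2 = binary-representsOddOrder {a} {β} {u} {v} u∈L v∈L
    (subst (+ 2 ∣_) (sym Q-u) (∣n⇒∣m*n (N₁ * N₂) (odd+odd-even N₁ N₂ odd₁ odd₂)))
    (odd-B-u-v odd₁ odd₂ odd₃)
    (subst (λ x → + 4 ∣ x - + 2) (sym Q-v)
      (odd-*-≡2-mod4 (N₁ * N₃) (N₁ + N₃) (odd-* N₁ N₃ odd₁ odd₃) 4∣N₁+N₃-2))

basis-frame : ∀ a {β : ℤ¹⁰} {j₁ j₂ j₃} →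
  j₁ ≢ j₂ → j₁ ≢ j₃ → j₂ ≢ j₃ → β j₁ ≡ β j₂ → β j₁ ≡ β j₃ → Frame a β
basis-frame a {β} {j₁} {j₂} {j₃} j₁≢j₂ j₁≢j₃ j₂≢j₃ β₁≡β₂ β₁≡β₃ = record
  { b = β j₁ ; f₁ = e j₁ ; f₂ = e j₂ ; f₃ = e j₃
  ; block₁ = e-block a j₁ refl
  ; block₂ = e-block a j₂ (sym β₁≡β₂)
  ; block₃ = e-block a j₃ (sym β₁≡β₃)
  ; f₁⊥f₂ = e-orthogonal a j₁≢j₂
  ; f₁⊥f₃ = e-orthogonal a j₁≢j₃
  ; f₂⊥f₃ = e-orthogonal a j₂≢j₃
  }

merged-frame : ∀ a {β : ℤ¹⁰} {j₁ j₂ j₃ j₄} → j₁ ≢ j₂ → j₁ ≢ j₃ → j₂ ≢ j₃ →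
  j₄ ≢ j₁ → j₄ ≢ j₂ → j₄ ≢ j₃ → β j₁ ≡ β j₂ → β j₁ ≡ β j₃ → β j₄ ≡ β j₁ → Frame a β
merged-frame a {β} {j₁} {j₂} {j₃} {j₄} j₁≢j₂ j₁≢j₃ j₂≢j₃ j₄≢j₁ j₄≢j₂ j₄≢j₃ β₁≡β₂ β₁≡β₃ β₄≡β₁ = record
  { b = β j₁ ; f₁ = e j₁ ; f₂ = e j₂ +ᵥ e j₄ ; f₃ = e j₃
  ; block₁ = e-block a j₁ refl
  ; block₂ = block-+ a (e-block a j₂ (sym β₁≡β₂)) (e-block a j₄ β₄≡β₁) (e-orthogonal a (≢-sym j₄≢j₂))
  ; block₃ = e-block a j₃ (sym β₁≡β₃)
  ; f₁⊥f₂ = trans (B-+ʳ a (e j₁) (e j₂) (e j₄))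
                  (cong₂ _+_ (e-orthogonal a j₁≢j₂) (e-orthogonal a (≢-sym j₄≢j₁)))
  ; f₁⊥f₃ = e-orthogonal a j₁≢j₃
  ; f₂⊥f₃ = trans (B-+ˡ a (e j₂) (e j₄) (e j₃))
                  (cong₂ _+_ (e-orthogonal a j₂≢j₃) (e-orthogonal a j₄≢j₃))
  }

odd-norm : ∀ a j → a j % 2 ≡ 1 → Odd (Qℤ a (e j))
odd-norm a j a-odd = subst Odd (sym (Q-e a j)) (odd-of-% (a j) a-odd)

evenUniversal-of-distinct-residues : ∀ a β {j₁ j₂ j₃} →
  j₁ ≢ j₂ → j₁ ≢ j₃ → j₂ ≢ j₃ → β j₁ ≡ β j₂ → β j₁ ≡ β j₃ →
  a j₁ % 2 ≡ 1 → a j₂ % 2 ≡ 1 → a j₃ % 2 ≡ 1 → a j₁ % 4 ≢ a j₂ % 4 → EvenUniversal a β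
evenUniversal-of-distinct-residues a β {j₁} {j₂} {j₃} j₁≢j₂ j₁≢j₃ j₂≢j₃ β₁≡β₂ β₁≡β₃ odd₁ odd₂ odd₃ a₁≢a₂ =
  frame-evenUniversal (basis-frame a j₁≢j₂ j₁≢j₃ j₂≢j₃ β₁≡β₂ β₁≡β₃)
    (odd-norm a j₁ odd₁) (odd-norm a j₂ odd₂) (odd-norm a j₃ odd₃)
    (subst₂ (λ x y → + 4 ∣ x + y) (sym (Q-e a j₁)) (sym (Q-e a j₂))
      (∣-of-%≡0 (a j₁ ℕ.+ a j₂) 4 (odd+odd-%4-distinct (a j₁) (a j₂) odd₁ odd₂ a₁≢a₂)))

representsOddOrder-of-equal-residues : ∀ a β {j₁ j₂ j₃} →
  j₁ ≢ j₂ → j₁ ≢ j₃ → j₂ ≢ j₃ → β j₁ ≡ β j₂ → β j₁ ≡ β j₃ →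
  a j₁ % 2 ≡ 1 → a j₂ % 2 ≡ 1 → a j₃ % 2 ≡ 1 → a j₁ % 4 ≡ a j₃ % 4 → RepresentsOddOrder a β
representsOddOrder-of-equal-residues a β {j₁} {j₂} {j₃} j₁≢j₂ j₁≢j₃ j₂≢j₃ β₁≡β₂ β₁≡β₃ odd₁ odd₂ odd₃ a₁≡a₃ =
  frame-representsOddOrder (basis-frame a j₁≢j₂ j₁≢j₃ j₂≢j₃ β₁≡β₂ β₁≡β₃)
    (odd-norm a j₁ odd₁) (odd-norm a j₂ odd₂) (odd-norm a j₃ odd₃)
    (subst₂ (λ x y → + 4 ∣ x + y - + 2) (sym (Q-e a j₁)) (sym (Q-e a j₃))
      (∣-of-%≡ (a j₁ ℕ.+ a j₃) 4 2 (odd+odd-%4-equal (a j₁) (a j₃) odd₁ odd₃ a₁≡a₃)))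

evenUniversal-of-fourth-index : ∀ a β {j₁ j₂ j₃ j₄} →
  j₁ ≢ j₂ → j₁ ≢ j₃ → j₂ ≢ j₃ → j₄ ≢ j₁ → j₄ ≢ j₂ → j₄ ≢ j₃ →
  β j₁ ≡ β j₂ → β j₁ ≡ β j₃ → β j₄ ≡ β j₁ →
  a j₁ % 2 ≡ 1 → a j₂ % 2 ≡ 1 → a j₃ % 2 ≡ 1 → a j₁ % 4 ≡ a j₂ % 4 → a j₄ % 4 ≡ 2 → EvenUniversal a β
evenUniversal-of-fourth-index a β {j₁} {j₂} {j₃} {j₄} j₁≢j₂ j₁≢j₃ j₂≢j₃ j₄≢j₁ j₄≢j₂ j₄≢j₃ β₁≡β₂ β₁≡β₃ β₄≡β₁
                              odd₁ odd₂ odd₃ a₁≡a₂ a₄≡2 =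
  frame-evenUniversal (merged-frame a j₁≢j₂ j₁≢j₃ j₂≢j₃ j₄≢j₁ j₄≢j₂ j₄≢j₃ β₁≡β₂ β₁≡β₃ β₄≡β₁)
    (odd-norm a j₁ odd₁)
    (subst Odd (sym N₂₄) (odd-of-% (a j₂ ℕ.+ a j₄) (odd+two-%2 (a j₂) (a j₄) odd₂ a₄≡2)))
    (odd-norm a j₃ odd₃)
    (subst₂ (λ x y → + 4 ∣ x + y) (sym (Q-e a j₁)) (sym N₂₄) (∣-of-%≡0 (a j₁ ℕ.+ (a j₂ ℕ.+ a j₄)) 4 sum≡0))
  where
  N₂₄ : Qℤ a (e j₂ +ᵥ e j₄) ≡ + (a j₂ ℕ.+ a j₄)
  N₂₄ = trans (Q-+-orthogonal a (e j₂) (e j₄) (e-orthogonal a (≢-sym j₄≢j₂))) (cong₂ _+_ (Q-e a j₂) (Q-e a j₄))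
  sum≡0 : (a j₁ ℕ.+ (a j₂ ℕ.+ a j₄)) % 4 ≡ 0
  sum≡0 = trans (cong (_% 4) (sym (ℕ.+-assoc (a j₁) (a j₂) (a j₄))))
                (two+two-%4 (a j₁ ℕ.+ a j₂) (a j₄) (odd+odd-%4-equal (a j₁) (a j₂) odd₁ odd₂ a₁≡a₂) a₄≡2)

lemma4p5 : (a : Fin 10 → ℕ) (β : Fin 10 → ℤ) →
    Bℤ a αℤ β ≡ + 1 →
    (j₁ j₂ j₃ : Fin 10) →
    j₁ ≢ j₂ → j₁ ≢ j₃ → j₂ ≢ j₃ →
    β j₁ ≡ β j₂ → β j₁ ≡ β j₃ →
    a j₁ % 2 ≡ 1 → a j₂ % 2 ≡ 1 → a j₃ % 2 ≡ 1 →
    (((a j₁ % 4 ≢ a j₂ % 4) ⊎ (a j₁ % 4 ≢ a j₃ % 4)) → EvenUniversal a β)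
    × ((a j₁ % 4 ≡ a j₂ % 4) → (a j₁ % 4 ≡ a j₃ % 4) → RepresentsOddOrder a β)
    × ((a j₁ % 4 ≡ a j₂ % 4) → (a j₁ % 4 ≡ a j₃ % 4) →
       (j₄ : Fin 10) → j₄ ≢ j₁ → j₄ ≢ j₂ → j₄ ≢ j₃ →
       β j₄ ≡ β j₁ → a j₄ % 4 ≡ 2 → EvenUniversal a β)
lemma4p5 a β _ j₁ j₂ j₃ j₁≢j₂ j₁≢j₃ j₂≢j₃ β₁≡β₂ β₁≡β₃ odd₁ odd₂ odd₃ =
  [ evenUniversal-of-distinct-residues a β j₁≢j₂ j₁≢j₃ j₂≢j₃ β₁≡β₂ β₁≡β₃ odd₁ odd₂ odd₃
  , evenUniversal-of-distinct-residues a β j₁≢j₃ j₁≢j₂ (≢-sym j₂≢j₃) β₁≡β₃ β₁≡β₂ odd₁ odd₃ odd₂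
  ]′ ,
  (λ _ a₁≡a₃ → representsOddOrder-of-equal-residues a β j₁≢j₂ j₁≢j₃ j₂≢j₃ β₁≡β₂ β₁≡β₃ odd₁ odd₂ odd₃ a₁≡a₃) ,
  (λ a₁≡a₂ _ j₄ j₄≢j₁ j₄≢j₂ j₄≢j₃ β₄≡β₁ a₄≡2 →
     evenUniversal-of-fourth-index a β j₁≢j₂ j₁≢j₃ j₂≢j₃ j₄≢j₁ j₄≢j₂ j₄≢j₃ β₁≡β₂ β₁≡β₃ β₄≡β₁
                                   odd₁ odd₂ odd₃ a₁≡a₂ a₄≡2)
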